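{- Let $G$ be a finite group and let $G=H_n\geq H_{n-1}\geq\dots\geq H_1\geq J$ be a chain of subgroups with $|J|=2$. Suppose that for each $1\leq i\leq n-1$ there exists a $J$-resolvable $(H_{i+1},H_i,3,1)$ difference family $\mathcal F_i$. Then $\mathcal F=\bigcup_{i=1}^{n-1}\mathcal F_i$ is a $J$-resolvable $(G,H_1,3,1)$ difference family. Furthermore, every strong multiplier of $\mathcal F_{n-1}$ is a strong multiplier of $\mathcal F$.
   Context: Groups are written additively (not necessarily abelian), $x-y:=x+(-y)$. For a $3$-subset $B=\{x,y,z\}$ of a group $G$, $\Delta B$ is the multiset $\{\pm(x-y),\pm(x-z),\pm(y-z)\}$; for a family $\mathcal F$ of $3$-subsets, $\Delta\mathcal F$ is the multiset union of the $\Delta B$ and $\Phi(\mathcal F)$ the multiset union of its blocks. For a subgroup $H$ of $G$, a $(G,H,3,1)$ difference family is a family $\mathcal F$ of $3$-subsets of $G$ with $\Delta\mathcal F=G\setminus H$ (each element exactly once). If $J\le H$ has order $2$, $\mathcal F$ is $J$-resolvable if $\Phi(\mathcal F)$ is a complete system of representatives for the left cosets $g+J$ of $J$ in $G$ not contained in $H$ (equivalently $\Phi(\mathcal F)+J=G\setminus H$). A multiplier of such an $\mathcal F$ is an automorphism $\mu$ of $G$ with $\{\mu(B):B\in\mathcal F\}=\mathcal F$; it is a strong multiplier if moreover it fixes $H$ elementwise. -}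

module Defs where

open import Level using (0ℓ)
open import Data.Nat using (ℕ; suc; _∸_)
open import Data.Product using (_×_; _,_; Σ; ∃)
open import Data.Sum using (_⊎_)
open import Data.List using (List; []; _∷_; length; filter; concatMap; map; applyUpTo)
open import Data.List.Membership.Propositional using (_∈_)
open import Data.List.Relation.Unary.All using (All)
open import Data.List.Relation.Unary.Unique.Propositional using (Unique)
open import Relation.Nullary using (¬_)
open import Relation.Unary using (Pred; Decidable)
open import Relation.Binary.PropositionalEquality using (_≡_)
open import Relation.Binary.Definitions using (DecidableEquality)
open import Algebra.Structures using (IsGroup)
open import Algebra.Bundles.Raw using (RawGroup)
open import Algebra.Morphism.Structures using (module GroupMorphisms)
open import Function.Bundles using (_⇔_)

-- A finite group, written multiplicatively in the library's notation
-- (_∙_ plays the role of the paper's additive +, ε of 0, _⁻¹ of unary -),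
-- with propositional equality, decidable equality and an enumeration
-- listing every element exactly once.
record FinGroup : Set₁ where
  field
    Carrier  : Set
    _∙_      : Carrier → Carrier → Carrier
    ε        : Carrier
    _⁻¹      : Carrier → Carrier
    isGroup  : IsGroup _≡_ _∙_ ε _⁻¹
    _≟_      : DecidableEquality Carrier
    elements : List Carrier
    complete : ∀ g → g ∈ elements
    unique   : Unique elements

  rawGroup : RawGroup 0ℓ 0ℓ
  rawGroup = record { Carrier = Carrier ; _≈_ = _≡_ ; _∙_ = _∙_ ; ε = ε ; _⁻¹ = _⁻¹ }

  _-_ : Carrier → Carrier → Carrier
  x - y = x ∙ (y ⁻¹)

module _ (G : FinGroup) where
  open FinGroup G

  mult : Carrier → List Carrier → ℕ
  mult g xs = length (filter (λ x → x ≟ g) xs)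

  record Subgroup : Set₁ where
    field
      member   : Pred Carrier 0ℓ
      member?  : Decidable member
      ε-closed : member ε
      ∙-closed : ∀ {x y} → member x → member y → member (x ∙ y)
      ⁻¹-closed : ∀ {x} → member x → member (x ⁻¹)

  open Subgroup public

  whole : Subgroup
  whole = record { member = λ _ → Data.Unit.⊤ ; member? = λ _ → Relation.Nullary.yes Data.Unit.tt
                 ; ε-closed = Data.Unit.tt ; ∙-closed = λ _ _ → Data.Unit.tt ; ⁻¹-closed = λ _ → Data.Unit.tt }
    where import Data.Unit ; import Relation.Nullary

  _≤ₛ_ : Subgroup → Subgroup → Set
  H ≤ₛ K = ∀ g → member H g → member K g

  order : Subgroup → ℕ
  order H = length (filter (member? H) elements)

  -- a block {x,y,z}, given by a triple of elements (required to be pairwise distinct)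
  Block : Set
  Block = Carrier × Carrier × Carrier

  Is3Subset : Block → Set
  Is3Subset (x , y , z) = ¬ x ≡ y × ¬ x ≡ z × ¬ y ≡ z

  _∈B_ : Carrier → Block → Set
  a ∈B (x , y , z) = a ≡ x ⊎ a ≡ y ⊎ a ≡ z

  _≈B_ : Block → Block → Set
  B ≈B C = ∀ a → (a ∈B B) ⇔ (a ∈B C)

  BlockIn : Subgroup → Block → Set
  BlockIn K (x , y , z) = member K x × member K y × member K z

  -- families of 3-subsets, multiset union = list concatenation
  Family : Set
  Family = List Block

  ΔB : Block → List Carrier
  ΔB (x , y , z) = (x - y) ∷ (y - x) ∷ (x - z) ∷ (z - x) ∷ (y - z) ∷ (z - y) ∷ []

  Δ : Family → List Carrier
  Δ = concatMap ΔB

  ΦB : Block → List Carrier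
  ΦB (x , y , z) = x ∷ y ∷ z ∷ []

  Φ : Family → List Carrier
  Φ = concatMap ΦB

  IsDF : Subgroup → Subgroup → Family → Set
  IsDF K H F =
    All (λ B → Is3Subset B × BlockIn K B) F
    × (∀ g → member K g → ¬ member H g → mult g (Δ F) ≡ 1)
    × (∀ g → (¬ member K g ⊎ member H g) → mult g (Δ F) ≡ 0)

  inCoset : Subgroup → Carrier → List Carrier → ℕ
  inCoset J g xs = length (filter (λ b → member? J ((g ⁻¹) ∙ b)) xs)

  JResolvable : Subgroup → Subgroup → Subgroup → Family → Set
  JResolvable K H J F =
    All (λ b → member K b × ¬ member H b) (Φ F)
    × (∀ g → member K g → ¬ member H g → inCoset J g (Φ F) ≡ 1)

  open GroupMorphisms rawGroup rawGroup using (IsGroupIsomorphism)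

  IsAutomorphism : (Carrier → Carrier) → Set
  IsAutomorphism μ = IsGroupIsomorphism μ

  mapBlock : (Carrier → Carrier) → Block → Block
  mapBlock μ (x , y , z) = μ x , μ y , μ z

  IsMultiplier : Family → (Carrier → Carrier) → Set
  IsMultiplier F μ =
    IsAutomorphism μ
    × (∀ {B} → B ∈ F → ∃ λ C → C ∈ F × mapBlock μ B ≈B C)
    × (∀ {C} → C ∈ F → ∃ λ B → B ∈ F × mapBlock μ B ≈B C)

  IsStrongMultiplier : Subgroup → Family → (Carrier → Carrier) → Set
  IsStrongMultiplier H F μ = IsMultiplier F μ × (∀ h → member H h → μ h ≡ h)

  unionFamilies : ℕ → (ℕ → Family) → Family
  unionFamilies n F = Data.List.concat (applyUpTo (λ k → F (suc k)) (n ∸ 1))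

{-# OPTIONS --safe #-}

-- The layers H₂ ∖ H₁, H₃ ∖ H₂, …, Hₙ ∖ Hₙ₋₁ partition G ∖ H₁. An element g is
-- counted, in Δ𝓕ᵢ and among the points of Φ(𝓕ᵢ) lying in g + J, only by the
-- family whose layer contains g, so for the union these counts telescope. For the
-- multiplier, the blocks of 𝓕₁, …, 𝓕ₙ₋₂ lie in Hₙ₋₁, which a strong multiplier
-- of 𝓕ₙ₋₁ fixes pointwise.
module Submission where

open import Defs
open import Data.Nat using (ℕ; zero; suc; _+_; _∸_; _≤_; _<_; z≤n; s≤s; _≤′_; ≤′-refl; ≤′-step)
open import Data.Nat.Properties using (≤-refl; ≤-trans; <⇒≤; ≤⇒≤′; ≤′⇒≤)
open import Relation.Binary.PropositionalEquality
  using (_≡_; refl; sym; trans; cong; cong₂; subst; module ≡-Reasoning)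
open import Data.Product using (_×_; _,_; proj₁; proj₂; ∃)
open import Level using (0ℓ)
open import Function using (_∘_)
open import Data.Sum using (_⊎_; inj₁; inj₂)
open import Data.Empty using (⊥-elim)
open import Data.Unit using (tt)
open import Data.List using (List; []; _++_; [_]; length; filter; concat; concatMap; applyUpTo)
open import Data.List.Properties
  using (applyUpTo-∷ʳ; concat-++; ++-identityʳ; concatMap-++; filter-++; length-++; filter-none)
open import Data.List.Relation.Unary.All as All using (All)
open import Data.List.Relation.Unary.All.Properties using (concat⁺; applyUpTo⁺₁; map⁺; map⁻; concat⁻)
open import Data.List.Membership.Propositional using (_∈_)
open import Data.List.Membership.Propositional.Properties using (∈-++⁻; ∈-++⁺ʳ)
open import Relation.Nullary using (¬_; Dec; yes; no)
open import Relation.Unary using (Pred; Decidable)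
open import Function.Bundles using (mk⇔)
open import Algebra.Bundles using (Group)
import Algebra.Properties.Group as GroupProperties

chain-mono : ∀ {n} (P : ℕ → Set) → (∀ i → 1 ≤ i → i < n → P i → P (suc i)) →
  ∀ {i j} → 1 ≤ i → i ≤ j → j ≤ n → P i → P j
chain-mono {n} P step {i} 1≤i i≤j = go (≤⇒≤′ i≤j)
  where
  go : ∀ {j} → i ≤′ j → j ≤ n → P i → P j
  go ≤′-refl          j≤n p = p
  go (≤′-step i≤′j) j<n p = step _ (≤-trans 1≤i (≤′⇒≤ i≤′j)) j<n (go i≤′j (<⇒≤ j<n) p)

IsIndicator : Set → Set → ℕ → Set
IsIndicator P Q c = (P → ¬ Q → c ≡ 1) × (¬ P ⊎ Q → c ≡ 0)

module Telescope {n : ℕ} (P : ℕ → Set) (P? : ∀ i → Dec (P i))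
    (step : ∀ i → 1 ≤ i → i < n → P i → P (suc i))
    (c s : ℕ → ℕ) (s-zero : s 0 ≡ 0) (s-suc : ∀ k → s (suc k) ≡ s k + c (suc k))
    (c-indicator : ∀ i → 1 ≤ i → i < n → IsIndicator (P (suc i)) (P i) (c i)) where

  telescope : ∀ k → k < n → IsIndicator (P (suc k)) (P 1) (s k)
  telescope zero    _   = (λ p ¬p → ⊥-elim (¬p p)) , λ _ → s-zero
  telescope (suc k) k<n = one , none
    where
    ih : IsIndicator (P (suc k)) (P 1) (s k)
    ih = telescope k (<⇒≤ k<n)

    c-one : P (suc (suc k)) → ¬ P (suc k) → c (suc k) ≡ 1
    c-one = proj₁ (c-indicator (suc k) (s≤s z≤n) k<n)

    c-zero : ¬ P (suc (suc k)) ⊎ P (suc k) → c (suc k) ≡ 0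
    c-zero = proj₂ (c-indicator (suc k) (s≤s z≤n) k<n)

    s-suc≡ : ∀ {a b} → s k ≡ a → c (suc k) ≡ b → s (suc k) ≡ a + b
    s-suc≡ sa cb = trans (s-suc k) (cong₂ _+_ sa cb)

    one : P (suc (suc k)) → ¬ P 1 → s (suc k) ≡ 1
    one p ¬p₁ with P? (suc k)
    ... | yes q = s-suc≡ (proj₁ ih q ¬p₁) (c-zero (inj₂ q))
    ... | no ¬q = s-suc≡ (proj₂ ih (inj₁ ¬q)) (c-one p ¬q)

    none : ¬ P (suc (suc k)) ⊎ P 1 → s (suc k) ≡ 0
    none (inj₁ ¬p) = s-suc≡ (proj₂ ih (inj₁ (¬p ∘ step (suc k) (s≤s z≤n) k<n)))
                            (c-zero (inj₁ ¬p))
    none (inj₂ p₁) = s-suc≡ (proj₂ ih (inj₂ p₁))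
                            (c-zero
                              (inj₂ (chain-mono P step (s≤s z≤n) (s≤s z≤n) (<⇒≤ k<n) p₁)))

concat-applyUpTo-suc : ∀ {A : Set} (f : ℕ → List A) k →
  concat (applyUpTo f (suc k)) ≡ concat (applyUpTo f k) ++ f k
concat-applyUpTo-suc f k = begin
  concat (applyUpTo f (suc k))           ≡⟨ cong concat (applyUpTo-∷ʳ f k) ⟨
  concat (applyUpTo f k ++ [ f k ])      ≡⟨ concat-++ (applyUpTo f k) [ f k ] ⟨
  concat (applyUpTo f k) ++ (f k ++ [])  ≡⟨ cong (concat (applyUpTo f k) ++_) (++-identityʳ (f k)) ⟩
  concat (applyUpTo f k) ++ f k          ∎
  where open ≡-Reasoning

count-concatMap-++ : ∀ {A B : Set} {P : Pred B 0ℓ} (P? : Decidable P) (f : A → List B) xs ys →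
  length (filter P? (concatMap f (xs ++ ys)))
    ≡ length (filter P? (concatMap f xs)) + length (filter P? (concatMap f ys))
count-concatMap-++ P? f xs ys = begin
  length (filter P? (concatMap f (xs ++ ys))) ≡⟨ cong (length ∘ filter P?) (concatMap-++ f xs ys) ⟩
  length (filter P? (fxs ++ fys))             ≡⟨ cong length (filter-++ P? fxs fys) ⟩
  length (filter P? fxs ++ filter P? fys)     ≡⟨ length-++ (filter P? fxs) ⟩
  length (filter P? fxs) + length (filter P? fys) ∎
  where
  open ≡-Reasoning
  fxs fys : List _
  fxs = concatMap f xs
  fys = concatMap f ys

module _ (G : FinGroup) where
  open FinGroup G

  group : Group 0ℓ 0ℓ
  group = record { isGroup = isGroup }

  open GroupProperties group using (\\-leftDividesˡ; ⁻¹-anti-homo-\\)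

  leftCoset-sym : ∀ (J : Subgroup G) {g b} → member J ((g ⁻¹) ∙ b) → member J ((b ⁻¹) ∙ g)
  leftCoset-sym J {g} {b} j = subst (member J) (⁻¹-anti-homo-\\ g b) (⁻¹-closed J j)

  leftCoset-member : ∀ (J K : Subgroup G) {g b} → _≤ₛ_ G J K →
    member J ((g ⁻¹) ∙ b) → member K g → member K b
  leftCoset-member J K {g} {b} J≤K j k =
    subst (member K) (\\-leftDividesˡ g b) (∙-closed K k (J≤K _ j))

  -- A left coset of J ≤ H ≤ K lies either inside H or outside K.
  inCoset-outside : ∀ (J H K : Subgroup G) {g xs} → _≤ₛ_ G J H → _≤ₛ_ G H K →
    All (λ b → member K b × ¬ member H b) xs → (¬ member K g ⊎ member H g) →
    inCoset G J g xs ≡ 0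
  inCoset-outside J H K {g} J≤H H≤K xs⊆K∖H g-out =
    cong length (filter-none (λ b → member? J ((g ⁻¹) ∙ b)) (All.map (notInCoset g-out) xs⊆K∖H))
    where
    notInCoset : ∀ {b} → (¬ member K g ⊎ member H g) →
      member K b × ¬ member H b → ¬ member J ((g ⁻¹) ∙ b)
    notInCoset (inj₁ g∉K) (b∈K , _)   j =
      g∉K (leftCoset-member J K (λ x → H≤K x ∘ J≤H x) (leftCoset-sym J j) b∈K)
    notInCoset (inj₂ g∈H) (_   , b∉H) j = b∉H (leftCoset-member J H J≤H j g∈H)

  BlockIn-mono : ∀ (K L : Subgroup G) {B} → _≤ₛ_ G K L → BlockIn G K B → BlockIn G L B
  BlockIn-mono K L K≤L (x∈K , y∈K , z∈K) = K≤L _ x∈K , K≤L _ y∈K , K≤L _ z∈K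

  mapBlock-fixed : ∀ (K : Subgroup G) {μ B} → (∀ h → member K h → μ h ≡ h) →
    BlockIn G K B → mapBlock G μ B ≡ B
  mapBlock-fixed K {B = x , y , z} fix (x∈K , y∈K , z∈K)
    rewrite fix x x∈K | fix y y∈K | fix z z∈K = refl

  ≈B-refl : ∀ B → _≈B_ G B B
  ≈B-refl B a = mk⇔ (λ p → p) (λ p → p)

  multiplier-++ˡ : ∀ {A F μ} → (∀ {B} → B ∈ A → mapBlock G μ B ≡ B) →
    IsMultiplier G F μ → IsMultiplier G (A ++ F) μ
  multiplier-++ˡ {A} {F} {μ} fixed (aut , forth , back) = aut , forth′ , back′
    where
    forth′ : ∀ {B} → B ∈ A ++ F → ∃ λ C → C ∈ A ++ F × _≈B_ G (mapBlock G μ B) C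
    forth′ {B} B∈ with ∈-++⁻ A B∈
    ... | inj₁ B∈A = B , B∈ , subst (λ C → _≈B_ G C B) (sym (fixed B∈A)) (≈B-refl B)
    ... | inj₂ B∈F with forth B∈F
    ...   | C , C∈F , μB≈C = C , ∈-++⁺ʳ A C∈F , μB≈C

    back′ : ∀ {C} → C ∈ A ++ F → ∃ λ B → B ∈ A ++ F × _≈B_ G (mapBlock G μ B) C
    back′ {C} C∈ with ∈-++⁻ A C∈
    ... | inj₁ C∈A = C , C∈ , subst (λ D → _≈B_ G D C) (sym (fixed C∈A)) (≈B-refl C)
    ... | inj₂ C∈F with back C∈F
    ...   | B , B∈F , μB≈C = B , ∈-++⁺ʳ A B∈F , μB≈C

  IsDF-whole : ∀ (K H : Subgroup G) F → (∀ g → member K g) →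
    IsDF G K H F → IsDF G (whole G) H F
  IsDF-whole K H F K-full (blocks , once , never) =
      All.map (λ (distinct , _) → distinct , tt , tt , tt) blocks
    , (λ g _ g∉H → once g (K-full g) g∉H)
    , λ { g (inj₁ g∉G) → ⊥-elim (g∉G tt) ; g (inj₂ g∈H) → never g (inj₂ g∈H) }

  JResolvable-whole : ∀ (K H J : Subgroup G) F → (∀ g → member K g) →
    JResolvable G K H J F → JResolvable G (whole G) H J F
  JResolvable-whole K H J F K-full (points , once) =
    All.map (λ (_ , b∉H) → tt , b∉H) points , λ g _ g∉H → once g (K-full g) g∉H

module DifferenceFamilyChain (G : FinGroup) (n : ℕ) (H : ℕ → Subgroup G) (J : Subgroup G)
    (F : ℕ → Family G)
    (H-chain : ∀ i → 1 ≤ i → i < n → _≤ₛ_ G (H i) (H (suc i)))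
    (J≤H₁ : _≤ₛ_ G J (H 1))
    (F-resolvable : ∀ i → 1 ≤ i → i < n →
      IsDF G (H (suc i)) (H i) (F i) × JResolvable G (H (suc i)) (H i) J (F i)) where

  open FinGroup G

  ⋃ : ℕ → Family G
  ⋃ k = concat (applyUpTo (F ∘ suc) k)

  ⋃-suc : ∀ k → ⋃ (suc k) ≡ ⋃ k ++ F (suc k)
  ⋃-suc = concat-applyUpTo-suc (F ∘ suc)

  H-mono : ∀ {i j} → 1 ≤ i → i ≤ j → j ≤ n → _≤ₛ_ G (H i) (H j)
  H-mono 1≤i i≤j j≤n g =
    chain-mono (λ i → member (H i) g) (λ i 1≤i i<n → H-chain i 1≤i i<n g) 1≤i i≤j j≤n

  J≤H : ∀ {i} → 1 ≤ i → i ≤ n → _≤ₛ_ G J (H i)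
  J≤H 1≤i i≤n x = H-mono ≤-refl 1≤i i≤n x ∘ J≤H₁ x

  All-⋃ : ∀ {P : Block G → Set} k → (∀ {i} → i < k → All P (F (suc i))) → All P (⋃ k)
  All-⋃ k PF = concat⁺ (applyUpTo⁺₁ (F ∘ suc) k PF)

  module _ {i k} (i<k : i < k) (k<n : k < n) where

    private
      F-suc-resolvable : IsDF G (H (suc (suc i))) (H (suc i)) (F (suc i))
                         × JResolvable G (H (suc (suc i))) (H (suc i)) J (F (suc i))
      F-suc-resolvable = F-resolvable (suc i) (s≤s z≤n) (≤-trans (s≤s i<k) k<n)

      Hᵢ₊₂≤Hₖ₊₁ : _≤ₛ_ G (H (suc (suc i))) (H (suc k))
      Hᵢ₊₂≤Hₖ₊₁ = H-mono (s≤s z≤n) (s≤s i<k) k<n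

    blocks-F-suc : All (λ B → Is3Subset G B × BlockIn G (H (suc k)) B) (F (suc i))
    blocks-F-suc = All.map (λ (distinct , B⊆H) → distinct , widen B⊆H) (proj₁ (proj₁ F-suc-resolvable))
      where
      widen : ∀ {B} → BlockIn G (H (suc (suc i))) B → BlockIn G (H (suc k)) B
      widen = BlockIn-mono G (H (suc (suc i))) (H (suc k)) Hᵢ₊₂≤Hₖ₊₁

    points-F-suc : All (All (λ b → member (H (suc k)) b × ¬ member (H 1) b) ∘ ΦB G) (F (suc i))
    points-F-suc = map⁻ (concat⁻ (All.map inside (proj₁ (proj₂ F-suc-resolvable))))
      where
      inside : ∀ {b} → member (H (suc (suc i))) b × ¬ member (H (suc i)) b →
        member (H (suc k)) b × ¬ member (H 1) b
      inside (b∈ , b∉) = Hᵢ₊₂≤Hₖ₊₁ _ b∈ , b∉ ∘ H-mono ≤-refl (s≤s z≤n) (≤-trans i<k (<⇒≤ k<n)) _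

  module _ (cnt : Family G → ℕ) (cnt-[] : cnt [] ≡ 0)
      (cnt-++ : ∀ A B → cnt (A ++ B) ≡ cnt A + cnt B) (g : Carrier)
      (cnt-indicator : ∀ i → 1 ≤ i → i < n →
         IsIndicator (member (H (suc i)) g) (member (H i) g) (cnt (F i))) where

    count-⋃ : ∀ k → k < n → IsIndicator (member (H (suc k)) g) (member (H 1) g) (cnt (⋃ k))
    count-⋃ = Telescope.telescope (λ i → member (H i) g) (λ i → member? (H i) g)
      (λ i 1≤i i<n → H-chain i 1≤i i<n g) (cnt ∘ F) (cnt ∘ ⋃) cnt-[]
      (λ k → trans (cong cnt (⋃-suc k)) (cnt-++ (⋃ k) (F (suc k)))) cnt-indicator

  ⋃-isDF : ∀ k → k < n → IsDF G (H (suc k)) (H 1) (⋃ k)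
  ⋃-isDF k k<n = All-⋃ k (λ i<k → blocks-F-suc i<k k<n) , proj₁ ∘ count-Δ , proj₂ ∘ count-Δ
    where
    count-Δ : ∀ g → IsIndicator (member (H (suc k)) g) (member (H 1) g) (mult G g (Δ G (⋃ k)))
    count-Δ g = count-⋃ (λ A → mult G g (Δ G A)) refl (count-concatMap-++ (λ x → x ≟ g) (ΔB G)) g
      (λ i 1≤i i<n → let (_ , once , never) = proj₁ (F-resolvable i 1≤i i<n) in once g , never g)
      k k<n

  ⋃-resolvable : ∀ k → k < n → JResolvable G (H (suc k)) (H 1) J (⋃ k)
  ⋃-resolvable k k<n =
    concat⁺ (map⁺ (All-⋃ k (λ i<k → points-F-suc i<k k<n))) , λ g → proj₁ (count-cosets g)
    where
    count-cosets : ∀ g →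
      IsIndicator (member (H (suc k)) g) (member (H 1) g) (inCoset G J g (Φ G (⋃ k)))
    count-cosets g = count-⋃ (λ A → inCoset G J g (Φ G A)) refl
      (count-concatMap-++ (λ b → member? J ((g ⁻¹) ∙ b)) (ΦB G)) g
      (λ i 1≤i i<n → let (_ , points , once) = F-resolvable i 1≤i i<n in
           once g
         , inCoset-outside G J (H i) (H (suc i)) (J≤H 1≤i (<⇒≤ i<n)) (H-chain i 1≤i i<n) points)
      k k<n

  ⋃-strongMultiplier : ∀ k → 1 ≤ k → k < n → ∀ μ →
    IsStrongMultiplier G (H k) (F k) μ → IsStrongMultiplier G (H 1) (⋃ k) μ
  ⋃-strongMultiplier (suc k) _ k<n μ (multiplier , fixes) =
      subst (λ A → IsMultiplier G A μ) (sym (⋃-suc k)) (multiplier-++ˡ G fixed multiplier)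
    , λ h h∈H₁ → fixes h (H-mono ≤-refl (s≤s z≤n) (<⇒≤ k<n) h h∈H₁)
    where
    fixed : ∀ {B} → B ∈ ⋃ k → mapBlock G μ B ≡ B
    fixed B∈ = mapBlock-fixed G (H (suc k)) fixes
      (proj₂ (All.lookup (All-⋃ k (λ i<k → blocks-F-suc i<k (<⇒≤ k<n))) B∈))

proposition3p2 : (G : FinGroup) (n : ℕ) (H : ℕ → Subgroup G) (J : Subgroup G)
    (F : ℕ → Family G) →
    1 ≤ n →
    (∀ g → member (H n) g) →
    (∀ i → 1 ≤ i → i < n → _≤ₛ_ G (H i) (H (suc i))) →
    _≤ₛ_ G J (H 1) →
    order G J ≡ 2 →
    (∀ i → 1 ≤ i → i < n →
      IsDF G (H (suc i)) (H i) (F i) × JResolvable G (H (suc i)) (H i) J (F i)) →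
    (IsDF G (whole G) (H 1) (unionFamilies G n F)
      × JResolvable G (whole G) (H 1) J (unionFamilies G n F))
    × (2 ≤ n → ∀ μ → IsStrongMultiplier G (H (n ∸ 1)) (F (n ∸ 1)) μ →
         IsStrongMultiplier G (H 1) (unionFamilies G n F) μ)
proposition3p2 G (suc m) H J F _ H-full H-chain J≤H₁ _ F-resolvable =
    ( IsDF-whole G (H (suc m)) (H 1) (⋃ m) H-full (⋃-isDF m ≤-refl)
    , JResolvable-whole G (H (suc m)) (H 1) J (⋃ m) H-full (⋃-resolvable m ≤-refl))
  , λ { (s≤s 1≤m) → ⋃-strongMultiplier m 1≤m ≤-refl }
  where open DifferenceFamilyChain G (suc m) H J F H-chain J≤H₁ F-resolvable
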